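{- Let $T$ be a (left or right) concatenation tree and $\alpha_1,\dots,\alpha_t$ its node labels in RCL order, indices modulo $t$. Fix $j$. If $\alpha_j$ is periodic with period $p$ and acceptable range $\{kp+1,\dots,kp+p\}$, then $\mathrm{ap}(\alpha_j)^{n/p-k}$ is a suffix of the cyclic sequence $\mathrm{ap}(\alpha_{j+1},\dots,\alpha_t,\alpha_1,\dots,\alpha_j)$ (a rotation of $\mathrm{RCL}(T)$), considered cyclically.
   Context: Strings of length $n$ over a finite ordered alphabet. $\mathrm{ap}(\alpha)$ is the shortest $\beta$ with $\alpha=\beta^q$ for some $q\ge1$; $|\beta|$ is the period; $\alpha$ is periodic if its period is less than $n$; $\mathrm{ap}(\gamma_1,\dots,\gamma_s)=\mathrm{ap}(\gamma_1)\cdots\mathrm{ap}(\gamma_s)$. A PCR-based cycle-joining tree $\mathcal{T}$ is a rooted tree whose nodes are distinct rotation classes of strings, each named by its lexicographically least rotation (necklace), where the edge from node $u$ to child $v$ is labeled by a conjugate pair $(\mathtt{x}\beta,\mathtt{y}\beta)$ ($\mathtt{x}\neq\mathtt{y}$ symbols, $|\beta|=n-1$) with $\mathtt{x}\beta$ a rotation in $u$ and $\mathtt{y}\beta$ a rotation in $v$; it satisfies the Chain Property if no node has two children with edge labels sharing the same $\beta$. A concatenation tree $\mathrm{concat}(\mathcal{T},c,\ell)$, for such $\mathcal{T}$ with the Chain Property, $c\in\{1,\dots,n\}$, $\ell\in\{\mathit{left},\mathit{right}\}$, has the same nodes and parent relation, each node carrying a label (a rotation in its class) and a change index: the root has label its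 necklace and change index $c$; if a node has label $\alpha$, change index $c'$ and period $p$, with $jp<c'\le jp+p$, its acceptable range is $\{jp+1,\dots,jp+p\}$; a child joined by $(\mathtt{x}\beta,\mathtt{y}\beta)$ gets label $\beta_1\mathtt{y}\beta_2$ and change index $|\beta_1|+1$, where $\alpha=\beta_1\mathtt{x}\beta_2$ is the unique factorization with $\beta_2\beta_1=\beta$ and $|\beta_1|+1$ in the acceptable range. Children with change index $<c'$ are left-children, $>c'$ right-children, and $=c'$ left-children if $\ell=\mathit{left}$, right-children if $\ell=\mathit{right}$; each type ordered by increasing change index. RCL order: recursively, the right-children subtrees first to last, then the node, then the left-children subtrees first to last; $\mathrm{RCL}(T)=\mathrm{ap}(\alpha_1,\dots,\alpha_t)$. -}

module Defs where

open import Data.Nat using (ℕ; zero; suc; _+_; _*_; _∸_; _≤_; _<_; _≡ᵇ_; _<ᵇ_)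
open import Data.Fin as Fin using (Fin)
open import Data.List using (List; []; _∷_; _++_; length; take; drop; concat; concatMap; replicate; map; upTo; filter)
open import Data.List.Properties using (≡-dec)
open import Data.List.Relation.Unary.Unique.Propositional using (Unique)
open import Data.Bool using (Bool; true; false; if_then_else_; _∧_; _∨_)
open import Data.Product using (Σ; ∃; ∃-syntax; _×_; _,_; proj₁)
open import Data.Sum using (_⊎_)
open import Data.Unit using (⊤)
open import Data.Empty using (⊥)
open import Relation.Nullary using (¬_; does)
open import Relation.Binary.PropositionalEquality using (_≡_)

Str : ℕ → Set
Str σ = List (Fin σ)

pow : ∀ {A : Set} → List A → ℕ → List A
pow β q = concat (replicate q β)

rot : ∀ {A : Set} → ℕ → List A → List A
rot i α = drop i α ++ take i α

IsRotationOf : ∀ {A : Set} → List A → List A → Set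
IsRotationOf γ α = Σ ℕ λ i → i < length α × γ ≡ rot i α

_≤L_ : ∀ {σ} → Str σ → Str σ → Set
[] ≤L _ = ⊤
(x ∷ xs) ≤L [] = ⊥
(x ∷ xs) ≤L (y ∷ ys) = x Fin.< y ⊎ (x ≡ y × xs ≤L ys)

IsNecklace : ∀ {σ} → Str σ → Set
IsNecklace α = ∀ i → i < length α → α ≤L rot i α

isRootLen : ∀ {σ} → Str σ → ℕ → Bool
isRootLen {σ} α p = anyQ (upTo (suc (length α)))
  where
  anyQ : List ℕ → Bool
  anyQ [] = false
  anyQ (q ∷ qs) = does (≡-dec Fin._≟_ α (pow (take p α) q)) ∨ anyQ qs

firstRoot : ∀ {σ} → Str σ → List ℕ → ℕ
firstRoot α [] = length α
firstRoot α (p ∷ ps) = if isRootLen α p then p else firstRoot α ps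

period : ∀ {σ} → Str σ → ℕ
period α = firstRoot α (map suc (upTo (length α)))

-- ap(α): the shortest β with α = β^q, q ≥ 1
ap : ∀ {σ} → Str σ → Str σ
ap α = take (period α) α

-- Each node is named by its necklace; each child edge carries the
-- conjugate pair (x β , y β), stored as the triple x, y, β.
data CJTree (σ : ℕ) : Set where
  cnode : (neck : Str σ) → (children : List (Fin σ × Fin σ × Str σ × CJTree σ)) → CJTree σ

name : ∀ {σ} → CJTree σ → Str σ
name (cnode neck _) = neck

mutual
  names : ∀ {σ} → CJTree σ → List (Str σ)
  names (cnode neck cs) = neck ∷ namesF cs

  namesF : ∀ {σ} → List (Fin σ × Fin σ × Str σ × CJTree σ) → List (Str σ)
  namesF [] = []
  namesF ((_ , _ , _ , t) ∷ cs) = names t ++ namesF cs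

mutual
  data WellFormed {σ} (n : ℕ) : CJTree σ → Set where
    wf : ∀ {neck cs} → length neck ≡ n → IsNecklace neck →
         WellFormedEdges n neck cs → WellFormed n (cnode neck cs)

  data WellFormedEdges {σ} (n : ℕ) (u : Str σ) : List (Fin σ × Fin σ × Str σ × CJTree σ) → Set where
    []ᵉ : WellFormedEdges n u []
    _∷ᵉ_ : ∀ {x y β t cs} →
           (¬ x ≡ y) × suc (length β) ≡ n ×
           IsRotationOf (x ∷ β) u × IsRotationOf (y ∷ β) (name t) × WellFormed n t →
           WellFormedEdges n u cs → WellFormedEdges n u ((x , y , β , t) ∷ cs)

IsPCRTree : ∀ {σ} → ℕ → CJTree σ → Set
IsPCRTree n T = WellFormed n T × Unique (names T)

-- Chain Property: no node has two children whose edge labels share β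
mutual
  data ChainProperty {σ} : CJTree σ → Set where
    chain : ∀ {neck cs} → Unique (map (λ e → proj₁ (Data.Product.proj₂ (Data.Product.proj₂ e))) cs) →
            ChainPropertyF cs → ChainProperty (cnode neck cs)

  data ChainPropertyF {σ} : List (Fin σ × Fin σ × Str σ × CJTree σ) → Set where
    []ᶜ : ChainPropertyF []
    _∷ᶜ_ : ∀ {x y β t cs} → ChainProperty t → ChainPropertyF cs → ChainPropertyF ((x , y , β , t) ∷ cs)

data LTree (σ : ℕ) : Set where
  lnode : (label : Str σ) → (ci : ℕ) → (children : List (LTree σ)) → LTree σ

label : ∀ {σ} → LTree σ → Str σ
label (lnode α _ _) = α

changeIndex : ∀ {σ} → LTree σ → ℕ
changeIndex (lnode _ c _) = c

InRange : (p c' i : ℕ) → Set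
InRange p c' i = Σ ℕ λ j → j * p < c' × c' ≤ j * p + p × j * p < i × i ≤ j * p + p

-- ConcatRel T L : L carries the labels/change indices that
-- concat(T,c,ℓ) assigns below the (already labelled) root of L
mutual
  data ConcatRel {σ} : CJTree σ → LTree σ → Set where
    crel : ∀ {neck cs α c' lcs} → ChildrenRel α c' cs lcs →
           ConcatRel (cnode neck cs) (lnode α c' lcs)

  data ChildrenRel {σ} (α : Str σ) (c' : ℕ) :
         List (Fin σ × Fin σ × Str σ × CJTree σ) → List (LTree σ) → Set where
    []ʳ : ChildrenRel α c' [] []
    child : ∀ {x y β t cs lcs} (β₁ β₂ : Str σ) (lcs' : List (LTree σ)) →
            α ≡ β₁ ++ x ∷ β₂ → β₂ ++ β₁ ≡ β →
            InRange (period α) c' (suc (length β₁)) →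
            ConcatRel t (lnode (β₁ ++ y ∷ β₂) (suc (length β₁)) lcs') →
            ChildrenRel α c' cs lcs →
            ChildrenRel α c' ((x , y , β , t) ∷ cs) (lnode (β₁ ++ y ∷ β₂) (suc (length β₁)) lcs' ∷ lcs)

data Side : Set where
  left right : Side

-- L = concat(T, c, ℓ) (the side ℓ only matters for the RCL order)
IsConcatTree : ∀ {σ} → CJTree σ → ℕ → LTree σ → Set
IsConcatTree T c L = label L ≡ name T × changeIndex L ≡ c × ConcatRel T L

isRightChild : Side → ℕ → ℕ → Bool
isRightChild left c' i = c' <ᵇ i
isRightChild right c' i = (c' <ᵇ i) ∨ (i ≡ᵇ c')

not : Bool → Bool
not true = false
not false = true

mutual
  rcl : ∀ {σ} → Side → LTree σ → List (Str σ × ℕ)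
  rcl ℓ (lnode α c' cs) =
    concatMap (λ i → rclAt ℓ i cs) (filter (λ i → Data.Bool.T? (isRightChild ℓ c' i)) idx)
    ++ (α , c') ∷
    concatMap (λ i → rclAt ℓ i cs) (filter (λ i → Data.Bool.T? (not (isRightChild ℓ c' i))) idx)
    where idx = map suc (upTo (length α))

  rclAt : ∀ {σ} → Side → ℕ → List (LTree σ) → List (Str σ × ℕ)
  rclAt ℓ i [] = []
  rclAt ℓ i (t ∷ ts) = (if changeIndex t ≡ᵇ i then rcl ℓ t else []) ++ rclAt ℓ i ts

apSeq : ∀ {σ} → List (Str σ × ℕ) → Str σ
apSeq xs = concatMap (λ e → ap (proj₁ e)) xs

CyclicSuffix : ∀ {A : Set} → List A → List A → Set
CyclicSuffix w S = ∃[ m ] ∃[ u ] u ++ w ≡ pow S m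

-- Read the cyclic sequence apSeq(RCL(T))^∞ as a text, and call a piece of it comparable with
-- a string s when one of the two is a suffix of the other. Invariant: wherever a node (α, c)
-- with period p and block k (kp < c ≤ kp + p) occurs, the text up to and including ap(α) is
-- comparable with the tail of α after position kp, i.e. with ap(α)^(n/p − k). It holds
-- subtree by subtree along the RCL order: the label of a child joined at change index i
-- agrees with α after position i, and the right children of (α, c) have change indices in
-- [c, kp + p], so just before ap(α) the text is comparable with the tail of α after kp + p;
-- appending ap(α) gives the tail after kp; the left children, with indices in (kp, c], lead
-- to the tail after c, where the next round of the cyclic text starts again. After |w| rounds
-- the text before the chosen occurrence is longer than w = ap(α)^(n/p − k), so comparability
-- becomes the suffix relation.
module Submission where

open import Defs
open import Data.Nat using (ℕ; suc; _*_; _∸_; _+_; _≤_; _<_)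
open import Data.List using (List; _∷_; []; _++_; length)
open import Data.Product using (_×_; _,_)
open import Relation.Binary.PropositionalEquality using (_≡_)

open import Data.Bool using (Bool; true; false; T; T?; _∨_; if_then_else_)
open import Data.Bool.ListAction using (any)
open import Data.Bool.Properties using (T-≡; T-∨)
open import Data.Empty using (⊥-elim)
open import Data.Fin as Fin using ()
open import Data.List using (take; drop; map; upTo; applyUpTo; filter; concatMap)
open import Data.List.Properties
  using (≡-dec; ++-assoc; ++-identityʳ; length-++; length-take; take-all; drop-drop; drop-[]; take++drop≡id; concatMap-++; ∷-injectiveʳ)
open import Data.List.Relation.Unary.All as All using (All; []; _∷_)
import Data.List.Relation.Unary.All.Properties as All
open import Data.List.Relation.Unary.AllPairs using (AllPairs; []; _∷_)
import Data.List.Relation.Unary.AllPairs.Properties as AllPairs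
import Data.List.Relation.Unary.Any as Any
import Data.List.Relation.Unary.Any.Properties as Any
open import Data.Nat using (zero; z≤n; s≤s; z<s; _≡ᵇ_; _<?_; _≤?_; NonZero; >-nonZero)
open import Data.Nat.DivMod using (_/_; _%_; m≡m%n+[m/n]*n; m%n<n; m/n*n≤m)
open import Data.Nat.Properties
open import Data.Product using (∃-syntax; proj₁; proj₂)
open import Data.Sum using (_⊎_; inj₁; inj₂)
open import Data.Unit using (⊤; tt)
open import Function using (_∘_)
open import Function.Bundles using (Equivalence)
open import Relation.Binary.Definitions using (tri<; tri≈; tri>)
open import Relation.Binary.PropositionalEquality using (refl; sym; trans; cong; subst; subst₂; _≗_; module ≡-Reasoning)
open import Relation.Nullary using (¬_; Dec; does; yes; no)
open import Relation.Nullary.Decidable using (_×-dec_; map′)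
open import Relation.Unary using (Decidable)

module _ {A : Set} where

  infix 4 _IsSuffixOf_

  _IsSuffixOf_ : List A → List A → Set
  s IsSuffixOf t = ∃[ u ] u ++ s ≡ t

  Comparable : List A → List A → Set
  Comparable t s = s IsSuffixOf t ⊎ t IsSuffixOf s

  isSuffixOf-refl : ∀ s → s IsSuffixOf s
  isSuffixOf-refl s = [] , refl

  isSuffixOf-trans : ∀ {r s t} → r IsSuffixOf s → s IsSuffixOf t → r IsSuffixOf t
  isSuffixOf-trans {r} (u , refl) (v , refl) = v ++ u , ++-assoc v u r

  isSuffixOf⇒length-≤ : ∀ {s t} → s IsSuffixOf t → length s ≤ length t
  isSuffixOf⇒length-≤ {s} (u , refl) = ≤-trans (m≤n+m (length s) (length u)) (≤-reflexive (sym (length-++ u)))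

  isSuffixOf-≡ : ∀ {s t} → s IsSuffixOf t → length t ≤ length s → s ≡ t
  isSuffixOf-≡ ([] , refl) _ = refl
  isSuffixOf-≡ (x ∷ u , refl) h = ⊥-elim (1+n≰n (≤-trans (s≤s (isSuffixOf⇒length-≤ (u , refl))) h))

  drop-isSuffixOf : ∀ {j i} → j ≤ i → (x : List A) → drop i x IsSuffixOf drop j x
  drop-isSuffixOf {j} {i} j≤i x = take (i ∸ j) (drop j x) , (begin
    take (i ∸ j) (drop j x) ++ drop i x               ≡⟨ cong (λ m → take (i ∸ j) (drop j x) ++ drop m x) (m+[n∸m]≡n j≤i) ⟨
    take (i ∸ j) (drop j x) ++ drop (j + (i ∸ j)) x   ≡⟨ cong (take (i ∸ j) (drop j x) ++_) (drop-drop j (i ∸ j) x) ⟨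
    take (i ∸ j) (drop j x) ++ drop (i ∸ j) (drop j x) ≡⟨ take++drop≡id (i ∸ j) (drop j x) ⟩
    drop j x                                          ∎)
    where open ≡-Reasoning

  ++-comparable : ∀ (u v : List A) {s t} → u ++ s ≡ v ++ t → Comparable t s
  ++-comparable [] v e = inj₂ (v , sym e)
  ++-comparable (x ∷ u) [] e = inj₁ (x ∷ u , e)
  ++-comparable (x ∷ u) (y ∷ v) e = ++-comparable u v (∷-injectiveʳ e)

  isSuffixOf-comparable : ∀ {r s t} → s IsSuffixOf r → t IsSuffixOf r → Comparable t s
  isSuffixOf-comparable (u , e) (v , e′) = ++-comparable u v (trans e (sym e′))

  comparable-[] : ∀ s → Comparable [] s
  comparable-[] s = inj₂ (s , ++-identityʳ s)

  comparable-isSuffixOf : ∀ {t s s′} → Comparable t s → s′ IsSuffixOf s → Comparable t s′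
  comparable-isSuffixOf (inj₁ s⊑t) s′⊑s = inj₁ (isSuffixOf-trans s′⊑s s⊑t)
  comparable-isSuffixOf (inj₂ t⊑s) s′⊑s = isSuffixOf-comparable s′⊑s t⊑s

  comparable-++ : ∀ {t s} a → Comparable t s → Comparable (t ++ a) (s ++ a)
  comparable-++ {t} {s} a (inj₁ (u , refl)) = inj₁ (u , sym (++-assoc u s a))
  comparable-++ {t} {s} a (inj₂ (u , refl)) = inj₂ (u , sym (++-assoc u t a))

  comparable⇒isSuffixOf : ∀ {t s} → Comparable t s → length s ≤ length t → s IsSuffixOf t
  comparable⇒isSuffixOf (inj₁ s⊑t) _ = s⊑t
  comparable⇒isSuffixOf (inj₂ t⊑s) |s|≤|t| = [] , sym (isSuffixOf-≡ t⊑s |s|≤|t|)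

module _ {A : Set} where

  pow-snoc : ∀ (a : List A) q → pow a q ++ a ≡ pow a (suc q)
  pow-snoc a zero = sym (++-identityʳ a)
  pow-snoc a (suc q) = trans (++-assoc a (pow a q) a) (cong (a ++_) (pow-snoc a q))

  length-pow : ∀ (a : List A) q → length (pow a q) ≡ q * length a
  length-pow a zero = refl
  length-pow a (suc q) = trans (length-++ a) (cong (length a +_) (length-pow a q))

  drop-length-++ : ∀ (a b : List A) m → drop (length a + m) (a ++ b) ≡ drop m b
  drop-length-++ [] b m = refl
  drop-length-++ (x ∷ a) b m = drop-length-++ a b m

  drop-pow : ∀ (a : List A) q k → drop (k * length a) (pow a q) ≡ pow a (q ∸ k)
  drop-pow a q zero = refl
  drop-pow a zero (suc k) = drop-[] (length a + k * length a)
  drop-pow a (suc q) (suc k) = trans (drop-length-++ a (pow a q) (k * length a)) (drop-pow a q k)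

  pow-rotate : ∀ (X Y : List A) m → pow (X ++ Y) m ++ X ≡ X ++ pow (Y ++ X) m
  pow-rotate X Y zero = sym (++-identityʳ X)
  pow-rotate X Y (suc m) = begin
    ((X ++ Y) ++ pow (X ++ Y) m) ++ X   ≡⟨ ++-assoc (X ++ Y) _ X ⟩
    (X ++ Y) ++ (pow (X ++ Y) m ++ X)   ≡⟨ cong ((X ++ Y) ++_) (pow-rotate X Y m) ⟩
    (X ++ Y) ++ (X ++ pow (Y ++ X) m)   ≡⟨ ++-assoc X Y _ ⟩
    X ++ (Y ++ (X ++ pow (Y ++ X) m))   ≡⟨ cong (X ++_) (++-assoc Y X _) ⟨
    X ++ ((Y ++ X) ++ pow (Y ++ X) m)   ∎
    where open ≡-Reasoning

  drop-after : ∀ (β₁ : List A) x β₂ → drop (suc (length β₁)) (β₁ ++ x ∷ β₂) ≡ β₂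
  drop-after [] x β₂ = refl
  drop-after (_ ∷ β₁) x β₂ = drop-after β₁ x β₂

comparable⇒cyclicSuffix : ∀ {A : Set} (X Y w : List A) → 1 ≤ length (Y ++ X) →
  Comparable (pow (X ++ Y) (length w) ++ X) w → CyclicSuffix w (Y ++ X)
comparable⇒cyclicSuffix {A} X Y w 1≤|S| text≍w = length w , w⊑Sᴹ
  where
  instance
    _ : NonZero (length (Y ++ X))
    _ = >-nonZero 1≤|S|
  Sᴹ : List A
  Sᴹ = pow (Y ++ X) (length w)
  Sᴹ⊑text : Sᴹ IsSuffixOf (pow (X ++ Y) (length w) ++ X)
  Sᴹ⊑text = X , sym (pow-rotate X Y (length w))
  |w|≤|Sᴹ| : length w ≤ length Sᴹ
  |w|≤|Sᴹ| = ≤-trans (m≤m*n (length w) (length (Y ++ X))) (≤-reflexive (sym (length-pow (Y ++ X) (length w))))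
  w⊑text : w IsSuffixOf (pow (X ++ Y) (length w) ++ X)
  w⊑text = comparable⇒isSuffixOf text≍w (≤-trans |w|≤|Sᴹ| (isSuffixOf⇒length-≤ Sᴹ⊑text))
  w⊑Sᴹ : w IsSuffixOf Sᴹ
  w⊑Sᴹ = comparable⇒isSuffixOf (isSuffixOf-comparable w⊑text Sᴹ⊑text) |w|≤|Sᴹ|

any-unfold : ∀ {A : Set} {p : A → Bool} {f : List A → Bool} →
  f [] ≡ false → (∀ x xs → f (x ∷ xs) ≡ p x ∨ f xs) → f ≗ any p
any-unfold f[] f∷ [] = f[]
any-unfold {p = p} f[] f∷ (x ∷ xs) = trans (f∷ x xs) (cong (p x ∨_) (any-unfold f[] f∷ xs))

-- The search inside isRootLen is a local function that cannot be named; the second `with`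
-- expression recovers it by unification with the abstracted goal.
isRootLen-any : ∀ {σ} (α : Str σ) p →
  isRootLen α p ≡ any (λ q → does (≡-dec Fin._≟_ α (pow (take p α) q))) (upTo (suc (length α)))
isRootLen-any α p with applyUpTo suc (length α) | any-unfold {p = λ q → does (≡-dec Fin._≟_ α (pow (take p α) q))} refl (λ _ _ → refl)
... | qs | unfold = cong (does (≡-dec Fin._≟_ α []) ∨_) (unfold qs)

does-sound : ∀ {P : Set} (d : Dec P) → T (does d) → P
does-sound (yes p) _ = p

isRootLen-sound : ∀ {σ} (α : Str σ) p → isRootLen α p ≡ true → ∃[ q ] α ≡ pow (take p α) q
isRootLen-sound α p root =
  let q , found = Any.satisfied (Any.any⁻ (λ q → does (≡-dec Fin._≟_ α (pow (take p α) q))) (upTo (suc (length α)))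
                                           (Equivalence.from T-≡ (trans (sym (isRootLen-any α p)) root)))
  in q , does-sound (≡-dec Fin._≟_ α (pow (take p α) q)) found

firstRoot-root : ∀ {σ} (α : Str σ) ps → ∃[ q ] α ≡ pow (take (firstRoot α ps) α) q
firstRoot-root α [] = 1 , sym (trans (++-identityʳ _) (take-all (length α) α ≤-refl))
firstRoot-root α (p ∷ ps) with isRootLen α p in root
... | true = isRootLen-sound α p root
... | false = firstRoot-root α ps

firstRoot-∈ : ∀ {σ} {P : ℕ → Set} (α : Str σ) ps → All P ps → P (length α) → P (firstRoot α ps)
firstRoot-∈ α [] [] P|α| = P|α|
firstRoot-∈ α (p ∷ ps) (Pp ∷ Pps) P|α| with isRootLen α p
... | true = Pp
... | false = firstRoot-∈ α ps Pps P|α|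

module _ {σ : ℕ} where

  ap-power : (α : Str σ) → ∃[ q ] α ≡ pow (ap α) q
  ap-power α = firstRoot-root α (map suc (upTo (length α)))

  period≤length : (α : Str σ) → period α ≤ length α
  period≤length α = firstRoot-∈ {P = _≤ length α} α (map suc (upTo (length α))) (All.map⁺ (All.all-upTo (length α))) ≤-refl

  1≤period : (α : Str σ) → 1 ≤ length α → 1 ≤ period α
  1≤period α = firstRoot-∈ {P = 1 ≤_} α (map suc (upTo (length α))) (All.map⁺ (All.universal (λ _ → s≤s z≤n) (upTo (length α))))

  length-ap : (α : Str σ) → length (ap α) ≡ period α
  length-ap α = trans (length-take (period α) α) (m≤n⇒m⊓n≡m (period≤length α))

  power-of-ap : ∀ (α : Str σ) q → 1 ≤ length α → q * period α ≡ length α → α ≡ pow (ap α) q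
  power-of-ap α q 1≤|α| q*p≡|α| with ap-power α
  ... | q′ , α≡ = subst (λ r → α ≡ pow (ap α) r) q′≡q α≡
    where
    instance
      _ : NonZero (period α)
      _ = >-nonZero (1≤period α 1≤|α|)
    q′≡q : q′ ≡ q
    q′≡q = *-cancelʳ-≡ q′ q (period α) (begin
      q′ * period α          ≡⟨ cong (q′ *_) (length-ap α) ⟨
      q′ * length (ap α)     ≡⟨ length-pow (ap α) q′ ⟨
      length (pow (ap α) q′) ≡⟨ cong length α≡ ⟨
      length α               ≡⟨ q*p≡|α| ⟨
      q * period α           ∎)
      where open ≡-Reasoning

  drop-block : ∀ (α : Str σ) q → α ≡ pow (ap α) q → ∀ k → drop (k * period α) α ≡ pow (ap α) (q ∸ k)
  drop-block α q α≡ k = begin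
    drop (k * period α) α                ≡⟨ cong (drop (k * period α)) α≡ ⟩
    drop (k * period α) (pow (ap α) q)   ≡⟨ cong (λ p → drop (k * p) (pow (ap α) q)) (length-ap α) ⟨
    drop (k * length (ap α)) (pow (ap α) q) ≡⟨ drop-pow (ap α) q k ⟩
    pow (ap α) (q ∸ k)                   ∎
    where open ≡-Reasoning

  drop-next-block : ∀ (α : Str σ) k → k * period α < length α →
    drop (k * period α + period α) α ++ ap α ≡ drop (k * period α) α
  drop-next-block α k kp<|α| with ap-power α
  ... | q , α≡ = begin
    drop (k * p + p) α ++ ap α    ≡⟨ cong (λ i → drop i α ++ ap α) (+-comm (k * p) p) ⟩
    drop (suc k * p) α ++ ap α    ≡⟨ cong (_++ ap α) (drop-block α q α≡ (suc k)) ⟩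
    pow (ap α) (q ∸ suc k) ++ ap α ≡⟨ pow-snoc (ap α) (q ∸ suc k) ⟩
    pow (ap α) (suc (q ∸ suc k))  ≡⟨ cong (pow (ap α)) (+-∸-assoc 1 k<q) ⟨
    pow (ap α) (q ∸ k)            ≡⟨ drop-block α q α≡ k ⟨
    drop (k * p) α                ∎
    where
    open ≡-Reasoning
    p : ℕ
    p = period α
    |α|≡q*p : length α ≡ q * p
    |α|≡q*p = trans (cong length α≡) (trans (length-pow (ap α) q) (cong (q *_) (length-ap α)))
    k<q : k < q
    k<q = ≰⇒> (λ q≤k → <⇒≱ kp<|α| (≤-trans (≤-reflexive |α|≡q*p) (*-monoˡ-≤ p q≤k)))

record InBlock (p k i : ℕ) : Set where
  constructor inBlock
  field
    start<i : k * p < i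
    i≤end : i ≤ k * p + p

inBlock? : ∀ p k → Decidable (InBlock p k)
inBlock? p k i = map′ (λ (start<i , i≤end) → inBlock start<i i≤end) (λ (inBlock start<i i≤end) → start<i , i≤end)
  ((k * p <? i) ×-dec (i ≤? k * p + p))

block-end≤start : ∀ p {j k} → j < k → j * p + p ≤ k * p
block-end≤start p {j} j<k = ≤-trans (≤-reflexive (+-comm (j * p) p)) (*-monoˡ-≤ p j<k)

inBlock-unique : ∀ {p j k c} → InBlock p j c → InBlock p k c → j ≡ k
inBlock-unique {p} {j} {k} (inBlock jp<c c≤jp+p) (inBlock kp<c c≤kp+p) with <-cmp j k
... | tri< j<k _ _ = ⊥-elim (<⇒≱ kp<c (≤-trans c≤jp+p (block-end≤start p j<k)))
... | tri≈ _ j≡k _ = j≡k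
... | tri> _ _ k<j = ⊥-elim (<⇒≱ jp<c (≤-trans c≤kp+p (block-end≤start p k<j)))

inBlock-exists : ∀ {p c} → 1 ≤ p → 1 ≤ c → ∃[ k ] InBlock p k c
inBlock-exists {suc p} {suc c} _ _ = c / suc p , inBlock (s≤s (m/n*n≤m c (suc p))) (begin
  suc c                              ≡⟨ cong suc (m≡m%n+[m/n]*n c (suc p)) ⟩
  suc (c % suc p) + c / suc p * suc p ≤⟨ +-monoˡ-≤ (c / suc p * suc p) (m%n<n c (suc p)) ⟩
  suc p + c / suc p * suc p          ≡⟨ +-comm (suc p) (c / suc p * suc p) ⟩
  c / suc p * suc p + suc p          ∎)
  where open ≤-Reasoning

<⇒isRightChild : ∀ ℓ {c i} → c < i → T (isRightChild ℓ c i)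
<⇒isRightChild left c<i = <⇒<ᵇ c<i
<⇒isRightChild right c<i = Equivalence.from T-∨ (inj₁ (<⇒<ᵇ c<i))

isRightChild⇒≤ : ∀ ℓ {c i} → T (isRightChild ℓ c i) → c ≤ i
isRightChild⇒≤ left {c} {i} isRight = <⇒≤ (<ᵇ⇒< c i isRight)
isRightChild⇒≤ right {c} {i} isRight with Equivalence.to T-∨ isRight
... | inj₁ c<ᵇi = <⇒≤ (<ᵇ⇒< c i c<ᵇi)
... | inj₂ i≡ᵇc = ≤-reflexive (sym (≡ᵇ⇒≡ i c i≡ᵇc))

T-not⇒¬T : ∀ {b} → T (not b) → ¬ T b
T-not⇒¬T {false} _ ()

¬isRightChild⇒≥ : ∀ ℓ {c i} → T (not (isRightChild ℓ c i)) → i ≤ c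
¬isRightChild⇒≥ ℓ isLeft = ≮⇒≥ (T-not⇒¬T isLeft ∘ <⇒isRightChild ℓ)

upTo-increasing : ∀ m → AllPairs _≤_ (map suc (upTo m))
upTo-increasing m = AllPairs.map⁺ (AllPairs.applyUpTo⁺₁ (λ i → i) m (λ i<j _ → s≤s (<⇒≤ i<j)))

apSeq-++ : ∀ {σ} (xs ys : List (Str σ × ℕ)) → apSeq (xs ++ ys) ≡ apSeq xs ++ apSeq ys
apSeq-++ = concatMap-++ (ap ∘ proj₁)

apSeq-split : ∀ {σ} pre (x : Str σ × ℕ) post → apSeq (pre ++ x ∷ post) ≡ (apSeq pre ++ ap (proj₁ x)) ++ apSeq post
apSeq-split pre x post = trans (apSeq-++ pre (x ∷ post)) (sym (++-assoc (apSeq pre) (ap (proj₁ x)) (apSeq post)))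

apSeq-rotate : ∀ {σ} pre (x : Str σ × ℕ) post → apSeq (post ++ pre ++ x ∷ []) ≡ apSeq post ++ (apSeq pre ++ ap (proj₁ x))
apSeq-rotate pre x post = trans (apSeq-++ post (pre ++ x ∷ []))
  (cong (apSeq post ++_) (trans (apSeq-++ pre (x ∷ [])) (cong (apSeq pre ++_) (++-identityʳ (ap (proj₁ x))))))

module RCLInvariant {σ : ℕ} (n : ℕ) (ℓ : Side) where

  Matched : Str σ → Str σ × ℕ → Set
  Matched t (α , c) = length α ≡ n ×
    (∀ {k} → InBlock (period α) k c → Comparable (t ++ ap α) (drop (k * period α) α))

  AllMatched : Str σ → List (Str σ × ℕ) → Set
  AllMatched t [] = ⊤
  AllMatched t ((α , c) ∷ xs) = Matched t (α , c) × AllMatched (t ++ ap α) xs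

  AllMatched-++⁺ : ∀ {t} xs {ys} → AllMatched t xs → AllMatched (t ++ apSeq xs) ys → AllMatched t (xs ++ ys)
  AllMatched-++⁺ {t} [] {ys} _ ys-ok = subst (λ u → AllMatched u ys) (++-identityʳ t) ys-ok
  AllMatched-++⁺ {t} ((α , c) ∷ xs) {ys} (α-ok , xs-ok) ys-ok =
    α-ok , AllMatched-++⁺ xs xs-ok (subst (λ u → AllMatched u ys) (sym (++-assoc t (ap α) (apSeq xs))) ys-ok)

  AllMatched-++⁻ : ∀ {t} xs {ys} → AllMatched t (xs ++ ys) → AllMatched (t ++ apSeq xs) ys
  AllMatched-++⁻ {t} [] {ys} ys-ok = subst (λ u → AllMatched u ys) (sym (++-identityʳ t)) ys-ok
  AllMatched-++⁻ {t} ((α , c) ∷ xs) {ys} (_ , rest) =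
    subst (λ u → AllMatched u ys) (++-assoc t (ap α) (apSeq xs)) (AllMatched-++⁻ xs rest)

  Advances : List (Str σ × ℕ) → Str σ → Str σ → Set
  Advances xs s s′ = ∀ t → Comparable t s → AllMatched t xs × Comparable (t ++ apSeq xs) s′

  advances-[] : ∀ {s s′} → s′ IsSuffixOf s → Advances [] s s′
  advances-[] s′⊑s t t≍s = tt , comparable-isSuffixOf (subst (λ u → Comparable u _) (sym (++-identityʳ t)) t≍s) s′⊑s

  advances-++ : ∀ {xs ys s s′ s″} → Advances xs s s′ → Advances ys s′ s″ → Advances (xs ++ ys) s s″
  advances-++ {xs} {ys} adv adv′ t t≍s with adv t t≍s
  ... | xs-ok , t′≍s′ with adv′ (t ++ apSeq xs) t′≍s′
  ... | ys-ok , t″≍s″ =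
    AllMatched-++⁺ xs xs-ok ys-ok ,
    subst (λ u → Comparable u _) (trans (++-assoc t (apSeq xs) (apSeq ys)) (cong (t ++_) (sym (apSeq-++ xs ys)))) t″≍s″

  advances-if : ∀ {b xs s} → (T b → Advances xs s s) → Advances (if b then xs else []) s s
  advances-if {true} adv = adv tt
  advances-if {false} _ = advances-[] (isSuffixOf-refl _)

  advances-node : ∀ {α : Str σ} {c k} → length α ≡ n → InBlock (period α) k c → k * period α < length α →
    Advances ((α , c) ∷ []) (drop (k * period α + period α) α) (drop (k * period α) α)
  advances-node {α} {c} {k} |α|≡n block kp<|α| t t≍next =
    ((|α|≡n , matched) , tt) , subst (λ u → Comparable u _) (cong (t ++_) (sym (++-identityʳ (ap α)))) t′≍tail
    where
    t′≍tail : Comparable (t ++ ap α) (drop (k * period α) α)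
    t′≍tail = subst (Comparable (t ++ ap α)) (drop-next-block α k kp<|α|) (comparable-++ (ap α) t≍next)
    matched : ∀ {k′} → InBlock (period α) k′ c → Comparable (t ++ ap α) (drop (k′ * period α) α)
    matched block′ = subst (λ j → Comparable (t ++ ap α) (drop (j * period α) α)) (inBlock-unique block block′) t′≍tail

  advances-concatMap : ∀ {α : Str σ} {B : ℕ → Set} {f : ℕ → List (Str σ × ℕ)} →
    Decidable B → (∀ {i} → ¬ B i → f i ≡ []) → (∀ i → Advances (f i) (drop i α) (drop i α)) →
    ∀ {j U} is → AllPairs _≤_ is → All (λ i → B i → j ≤ i × i ≤ U) is → j ≤ U →
    Advances (concatMap f is) (drop j α) (drop U α)
  advances-concatMap {α} B? skip step [] [] [] j≤U = advances-[] (drop-isSuffixOf j≤U α)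
  advances-concatMap {α} {f = f} B? skip step (i ∷ is) (i≤is ∷ sorted) (bound ∷ bounds) j≤U with B? i
  ... | yes b = advances-++ (advances-++ (advances-[] (drop-isSuffixOf (proj₁ (bound b)) α)) (step i))
                  (advances-concatMap B? skip step is sorted
                    (All.zipWith (λ (i≤i′ , bound′) b′ → i≤i′ , proj₂ (bound′ b′)) (i≤is , bounds)) (proj₂ (bound b)))
  ... | no ¬b rewrite skip ¬b = advances-concatMap B? skip step is sorted bounds j≤U

  rclAt-outside : ∀ {α : Str σ} {c′ cs lcs} → ChildrenRel α c′ cs lcs →
    ∀ {k i} → InBlock (period α) k c′ → ¬ InBlock (period α) k i → rclAt ℓ i lcs ≡ []
  rclAt-outside []ʳ _ _ = refl
  rclAt-outside {α} (child β₁ β₂ _ _ _ (j , jp<c′ , c′≤jp+p , jp<i₀ , i₀≤jp+p) _ rest) {k} {i} block outside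
    with suc (length β₁) ≡ᵇ i in i₀≡ᵇi
  ... | false = rclAt-outside rest block outside
  ... | true = ⊥-elim (outside (subst₂ (InBlock (period α)) (inBlock-unique (inBlock {k = j} jp<c′ c′≤jp+p) block)
                 (≡ᵇ⇒≡ (suc (length β₁)) i (subst T (sym i₀≡ᵇi) tt)) (inBlock {k = j} jp<i₀ i₀≤jp+p)))

  mutual
    rcl-advances : ∀ {Tr} {α : Str σ} {c′ lcs} → ConcatRel Tr (lnode α c′ lcs) → length α ≡ n → 1 ≤ c′ → c′ ≤ n →
      Advances (rcl ℓ (lnode α c′ lcs)) (drop c′ α) (drop c′ α)
    rcl-advances {α = α} {c′} {lcs} (crel children) |α|≡n 1≤c′ c′≤n
      with inBlock-exists (1≤period α (≤-trans 1≤c′ (≤-trans c′≤n (≤-reflexive (sym |α|≡n))))) 1≤c′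
    ... | k , block@(inBlock kp<c′ c′≤kp+p) =
      advances-++ (walk (λ i → T? (isRightChild ℓ c′ i)) c′≤kp+p
                     (λ right blockᵢ → isRightChild⇒≤ ℓ right , InBlock.i≤end blockᵢ))
        (advances-++ (advances-node {k = k} |α|≡n block (<-≤-trans kp<c′ (≤-trans c′≤n (≤-reflexive (sym |α|≡n)))))
                     (walk (λ i → T? (not (isRightChild ℓ c′ i))) (<⇒≤ kp<c′)
                        (λ left blockᵢ → <⇒≤ (InBlock.start<i blockᵢ) , ¬isRightChild⇒≥ ℓ left)))
      where
      idx : List ℕ
      idx = map suc (upTo (length α))
      walk : ∀ {P : ℕ → Set} (P? : Decidable P) {j U} → j ≤ U →
        (∀ {i} → P i → InBlock (period α) k i → j ≤ i × i ≤ U) →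
        Advances (concatMap (λ i → rclAt ℓ i lcs) (filter P? idx)) (drop j α) (drop U α)
      walk P? j≤U bound =
        advances-concatMap (inBlock? (period α) k) (rclAt-outside children block) (rclAt-advances children |α|≡n)
          (filter P? idx) (AllPairs.filter⁺ P? (upTo-increasing (length α)))
          (All.map bound (All.all-filter P? idx)) j≤U

    rclAt-advances : ∀ {α : Str σ} {c′ cs lcs} → ChildrenRel α c′ cs lcs → length α ≡ n →
      ∀ i → Advances (rclAt ℓ i lcs) (drop i α) (drop i α)
    rclAt-advances []ʳ _ i = advances-[] (isSuffixOf-refl _)
    rclAt-advances (child {x} {y} β₁ β₂ lcs′ refl _ _ rel rest) |α|≡n i =
      advances-++ (advances-if subtree) (rclAt-advances rest |α|≡n i)
      where
      |α′|≡n : length (β₁ ++ y ∷ β₂) ≡ n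
      |α′|≡n = trans (length-++ β₁) (trans (sym (length-++ β₁)) |α|≡n)
      i₀≤n : suc (length β₁) ≤ n
      i₀≤n = ≤-trans (m<m+n (length β₁) z<s) (≤-reflexive (trans (sym (length-++ β₁)) |α|≡n))
      subtree : T (suc (length β₁) ≡ᵇ i) →
        Advances (rcl ℓ (lnode (β₁ ++ y ∷ β₂) (suc (length β₁)) lcs′)) (drop i (β₁ ++ x ∷ β₂)) (drop i (β₁ ++ x ∷ β₂))
      subtree i₀≡ᵇi = subst (λ j → Advances _ (drop j (β₁ ++ x ∷ β₂)) (drop j (β₁ ++ x ∷ β₂))) (≡ᵇ⇒≡ (suc (length β₁)) i i₀≡ᵇi)
        (subst (λ s → Advances _ s s) (trans (drop-after β₁ y β₂) (sym (drop-after β₁ x β₂)))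
          (rcl-advances rel |α′|≡n (s≤s z≤n) i₀≤n))

  concatTree-allMatched : ∀ {T : CJTree σ} {c L} → IsPCRTree n T → 1 ≤ c → c ≤ n → IsConcatTree T c L →
    ∀ m → AllMatched (pow (apSeq (rcl ℓ L)) m) (rcl ℓ L)
  concatTree-allMatched {L = lnode α c lcs} (wf |α|≡n _ _ , _) 1≤c c≤n (refl , refl , rel) m =
    proj₁ (adv (pow R m) (rounds m))
    where
    R : Str σ
    R = apSeq (rcl ℓ (lnode α c lcs))
    adv : Advances (rcl ℓ (lnode α c lcs)) (drop c α) (drop c α)
    adv = rcl-advances rel |α|≡n 1≤c c≤n
    rounds : ∀ m → Comparable (pow R m) (drop c α)
    rounds zero = comparable-[] _
    rounds (suc m) = subst (λ u → Comparable u (drop c α)) (pow-snoc R m) (proj₂ (adv (pow R m) (rounds m)))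

lemma8 : ∀ {σ : ℕ} (n : ℕ) (T : CJTree σ) (c : ℕ) (ℓ : Side) (L : LTree σ) →
    IsPCRTree n T → ChainProperty T → 1 ≤ c → c ≤ n → IsConcatTree T c L →
    (pre post : List (Str σ × ℕ)) (α : Str σ) (cⱼ : ℕ) →
    rcl ℓ L ≡ pre ++ (α , cⱼ) ∷ post →
    period α < n →
    (k : ℕ) → k * period α < cⱼ → cⱼ ≤ k * period α + period α →
    (q : ℕ) → q * period α ≡ n →
    CyclicSuffix (pow (ap α) (q ∸ k)) (apSeq (post ++ pre ++ (α , cⱼ) ∷ []))
lemma8 {σ} n T c ℓ L pcr _ 1≤c c≤n concat pre post α cⱼ rcl≡ _ k kp<cⱼ cⱼ≤kp+p q q*p≡n =
  subst (CyclicSuffix w) (sym (apSeq-rotate pre (α , cⱼ) post))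
    (comparable⇒cyclicSuffix (A ++ B) C w 1≤|S| (subst₂ Comparable text≡ tail≡w (proj₂ matched (inBlock {k = k} kp<cⱼ cⱼ≤kp+p))))
  where
  open RCLInvariant n ℓ
  A B C w : Str σ
  A = apSeq pre
  B = ap α
  C = apSeq post
  w = pow (ap α) (q ∸ k)
  matched : Matched (pow (apSeq (rcl ℓ L)) (length w) ++ A) (α , cⱼ)
  matched = proj₁ (AllMatched-++⁻ pre (subst (AllMatched _) rcl≡ (concatTree-allMatched pcr 1≤c c≤n concat (length w))))
  1≤|α| : 1 ≤ length α
  1≤|α| = ≤-trans 1≤c (≤-trans c≤n (≤-reflexive (sym (proj₁ matched))))
  tail≡w : drop (k * period α) α ≡ w
  tail≡w = drop-block α q (power-of-ap α q 1≤|α| (trans q*p≡n (sym (proj₁ matched)))) k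
  1≤|S| : 1 ≤ length (C ++ (A ++ B))
  1≤|S| = ≤-trans (1≤period α 1≤|α|) (≤-trans (≤-reflexive (sym (length-ap α))) (isSuffixOf⇒length-≤ (C ++ A , ++-assoc C A B)))
  text≡ : (pow (apSeq (rcl ℓ L)) (length w) ++ A) ++ B ≡ pow ((A ++ B) ++ C) (length w) ++ (A ++ B)
  text≡ = trans (++-assoc _ A B)
    (cong (λ r → pow r (length w) ++ (A ++ B)) (trans (cong apSeq rcl≡) (apSeq-split pre (α , cⱼ) post)))
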